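{- Let $n\in\mathbb N$ and let $L=\sum_{i<n}L_i=L_0+\cdots+L_{n-1}$, where each $L_i\in\mathcal H$ is of the form $\sum_{\omega^*}L_{i,j}$ for some sequence $\langle L_{i,j}:j\in\omega\rangle$ in $\mathcal H$ satisfying condition $(*)$, and $L_i+L_{i+1}\notin\mathcal H$ for all $i<n-1$. Then: (a) if $f:L\hookrightarrow L$ is an order-embedding, then $f[L_i]\subseteq L_i$ for each $i<n$; (b) $\mathbb P(L)=\{\bigcup_{i<n}C_i: C_i\in\mathbb P(L_i)\text{ for all }i<n\}$; (c) the pre-order $\langle\mathbb P(L),\le\rangle$ is $\sigma$-closed.
   Context: $X\hookrightarrow Y$ means $X$ order-embeds into $Y$. $\sum_\omega L_i=L_0+L_1+\cdots$, $\sum_{\omega^*}L_i=\cdots+L_1+L_0$. A sequence $\langle L_i:i\in\omega\rangle$ satisfies $(*)$ if for each $i$ the set $\{j:L_i\hookrightarrow L_j\}$ is infinite. $\mathcal H$ is the smallest class of order types of countable linear orders containing the one-element type and containing $\sum_\omega L_i$ and $\sum_{\omega^*}L_i$ for every sequence $\langle L_i\rangle$ in $\mathcal H$ satisfying $(*)$. For a linear order $X$, $\mathbb P(X)=\{A\subseteq X:A\cong X\}$. On $\mathbb P(L)$, $A\le B$ iff for every $C\in\mathbb P(L)$ with $C\subseteq A$ there is $D\in\mathbb P(L)$ with $D\subseteq C\cap B$. A pre-order is $\sigma$-closed if every sequence $p_0\ge p_1\ge\cdots$ has a lower bound. -}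

module Defs where

open import Level using (0ℓ) renaming (suc to lsuc)
open import Data.Nat using (ℕ; suc; _≤_) renaming (_<_ to _<ℕ_)
open import Data.Fin using (Fin; toℕ) renaming (_<_ to _<F_)
open import Data.Unit using (⊤)
open import Data.Empty using (⊥)
open import Data.Sum using (_⊎_; inj₁; inj₂)
open import Data.Product using (Σ; _×_; _,_; ∃; proj₁; proj₂)
open import Relation.Nullary using (¬_)
open import Relation.Binary.PropositionalEquality using (_≡_)

-- Linearity is not built in:
-- every member of 𝓗 is automatically a linear order (pt is linear, sums of
-- linear orders are linear, isomorphism preserves linearity).
record LO : Set₁ where
  field
    Carrier : Set
    _<_     : Carrier → Carrier → Set
open LO public

IsEmbedding : (X Y : LO) → (Carrier X → Carrier Y) → Set
IsEmbedding X Y f = ∀ a b → (_<_ X a b → _<_ Y (f a) (f b)) × (_<_ Y (f a) (f b) → _<_ X a b)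

_↪_ : LO → LO → Set
X ↪ Y = ∃ λ (f : Carrier X → Carrier Y) → IsEmbedding X Y f

_≅_ : LO → LO → Set
X ≅ Y = Σ (Carrier X → Carrier Y) λ f → Σ (Carrier Y → Carrier X) λ g →
          (∀ x → g (f x) ≡ x) × (∀ y → f (g y) ≡ y) × IsEmbedding X Y f

𝟙 : LO
𝟙 = record { Carrier = ⊤ ; _<_ = λ _ _ → ⊥ }

data ωLt (L : ℕ → LO) : Σ ℕ (λ i → Carrier (L i)) → Σ ℕ (λ i → Carrier (L i)) → Set where
  fst< : ∀ {i j x y} → i <ℕ j → ωLt L (i , x) (j , y)
  snd< : ∀ {i x y} → _<_ (L i) x y → ωLt L (i , x) (i , y)

Σω : (ℕ → LO) → LO
Σω L = record { Carrier = Σ ℕ (λ i → Carrier (L i)) ; _<_ = ωLt L }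

data ω*Lt (L : ℕ → LO) : Σ ℕ (λ i → Carrier (L i)) → Σ ℕ (λ i → Carrier (L i)) → Set where
  fst< : ∀ {i j x y} → j <ℕ i → ω*Lt L (i , x) (j , y)
  snd< : ∀ {i x y} → _<_ (L i) x y → ω*Lt L (i , x) (i , y)

Σω* : (ℕ → LO) → LO
Σω* L = record { Carrier = Σ ℕ (λ i → Carrier (L i)) ; _<_ = ω*Lt L }

data FinLt {n : ℕ} (L : Fin n → LO) : Σ (Fin n) (λ i → Carrier (L i)) → Σ (Fin n) (λ i → Carrier (L i)) → Set where
  fst< : ∀ {i j x y} → i <F j → FinLt L (i , x) (j , y)
  snd< : ∀ {i x y} → _<_ (L i) x y → FinLt L (i , x) (i , y)

ΣFin : (n : ℕ) → (Fin n → LO) → LO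
ΣFin n L = record { Carrier = Σ (Fin n) (λ i → Carrier (L i)) ; _<_ = FinLt L }

data SumLt (X Y : LO) : Carrier X ⊎ Carrier Y → Carrier X ⊎ Carrier Y → Set where
  ll : ∀ {a b} → _<_ X a b → SumLt X Y (inj₁ a) (inj₁ b)
  lr : ∀ {a b} → SumLt X Y (inj₁ a) (inj₂ b)
  rr : ∀ {a b} → _<_ Y a b → SumLt X Y (inj₂ a) (inj₂ b)

_⊕_ : LO → LO → LO
X ⊕ Y = record { Carrier = Carrier X ⊎ Carrier Y ; _<_ = SumLt X Y }

-- Condition (*): for each i, {j : L i ↪ L j} is infinite (unbounded in ℕ).
Star : (ℕ → LO) → Set
Star L = ∀ i → ∀ m → ∃ λ j → m ≤ j × (L i ↪ L j)

-- The class 𝓗 (as a class of order types, hence closed under ≅).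
data 𝓗 : LO → Set₁ where
  one  : 𝓗 𝟙
  ωsum  : (L : ℕ → LO) → (∀ i → 𝓗 (L i)) → Star L → 𝓗 (Σω L)
  ω*sum : (L : ℕ → LO) → (∀ i → 𝓗 (L i)) → Star L → 𝓗 (Σω* L)
  iso  : ∀ {X Y} → 𝓗 X → X ≅ Y → 𝓗 Y

Subset : LO → Set₁
Subset X = Carrier X → Set

_⊆_ : ∀ {X} → Subset X → Subset X → Set
_⊆_ {X} A B = ∀ x → A x → B x

-- A ∈ ℙ(X): A ⊆ X and A (with the induced order) ≅ X, i.e. there is an
-- order-embedding g : X → X whose image is exactly A.
ℙ : (X : LO) → Subset X → Set
ℙ X A = Σ (Carrier X → Carrier X) λ g → IsEmbedding X X g ×
          (∀ x → A (g x)) × (∀ y → A y → ∃ λ x → g x ≡ y)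

Leℙ : (X : LO) → Subset X → Subset X → Set₁
Leℙ X A B = ∀ C → ℙ X C → _⊆_ {X} C A →
   ∃ λ (D : Subset X) → ℙ X D × (_⊆_ {X} D C) × (_⊆_ {X} D B)

σClosed : LO → Set₁
σClosed X = (p : ℕ → Subset X) → (∀ k → ℙ X (p k)) →
  (∀ k → Leℙ X (p (suc k)) (p k)) →
  ∃ λ (q : Subset X) → ℙ X q × (∀ k → Leℙ X q (p k))

module Submission where

-- After generalities on linear orders, embeddings and lexicographic sums,
-- the core is a collapsing principle for an ω*-sum Σω* N with (*): an
-- embedding of it into an ω- or ω*-sum with bounded index has eventually
-- constant index (excluded middle), so Σω* N embeds into one summand.  By
-- induction on 𝓗 this shows that no member of 𝓗 lies between Σω* N and a
-- summand N j (notBetween); hence a block Lᵢ embeds neither into a summand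
-- of itself nor (by Lᵢ + Lᵢ₊₁ ∉ 𝓗) into one of the block before it.  Part
-- (a) follows: a block moved down or up could be collapsed into such a
-- summand.  Part (b) is bookkeeping given (a), and (c) is a fusion argument
-- building, from p₀ ≥ p₁ ≥ ⋯, one copy of L that lies eventually below each pₖ.

open import Defs
open import Level using (0ℓ; lift; lower) renaming (suc to lsuc)
open import Axiom.ExcludedMiddle using (ExcludedMiddle)
open import Data.Nat using (ℕ; zero; suc; _≤_; _>_; z≤n; s≤s; _∸_; _+_) renaming (_<_ to _<ℕ_)
open import Data.Nat.Properties
open import Data.Fin using (Fin; toℕ; fromℕ<) renaming (_<_ to _<F_)
import Data.Fin.Properties as Fin
open import Data.Product using (Σ; _×_; _,_; ∃; proj₁; proj₂)
open import Data.Product.Properties using (,-injectiveʳ-UIP)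
open import Axiom.UniquenessOfIdentityProofs.WithK using (uip)
open import Data.Sum using (_⊎_; inj₁; inj₂)
open import Data.Empty using (⊥-elim)
open import Data.Unit using (tt)
open import Function using (_∘_)
open import Relation.Nullary using (¬_; Dec; yes; no)
open import Relation.Nullary.Decidable using (map′)
open import Relation.Binary.PropositionalEquality using (_≡_; refl; sym; trans; cong; subst; subst₂)
open import Relation.Binary.Structures using (IsStrictTotalOrder)
open import Relation.Binary.Definitions using (Tri; tri<; tri≈; tri>)
import Relation.Binary.Construct.Flip.EqAndOrd as Flip

infix 4 _⊢_<_
_⊢_<_ : (X : LO) → Carrier X → Carrier X → Set
X ⊢ a < b = _<_ X a b

record IsLinear (X : LO) : Set where
  field
    irreflexive  : ∀ x → ¬ (X ⊢ x < x)
    transitive   : ∀ {x y z} → X ⊢ x < y → X ⊢ y < z → X ⊢ x < z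
    trichotomous : ∀ x y → X ⊢ x < y ⊎ x ≡ y ⊎ X ⊢ y < x
open IsLinear public

strictTotal⇒linear : {A : Set} {_≺_ : A → A → Set} → IsStrictTotalOrder _≡_ _≺_ →
  IsLinear (record { Carrier = A ; _<_ = _≺_ })
strictTotal⇒linear {_≺_ = _≺_} sto = record
  { irreflexive  = λ x → irrefl refl
  ; transitive   = ≺-trans
  ; trichotomous = λ x y → fromTri (compare x y) }
  where
  open IsStrictTotalOrder sto using (irrefl; compare) renaming (trans to ≺-trans)
  fromTri : ∀ {x y} → Tri (x ≺ y) (x ≡ y) (y ≺ x) → x ≺ y ⊎ x ≡ y ⊎ y ≺ x
  fromTri (tri< a _ _) = inj₁ a
  fromTri (tri≈ _ b _) = inj₂ (inj₁ b)
  fromTri (tri> _ _ c) = inj₂ (inj₂ c)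

-- The codomain Z of a
-- composite occurs only applied to non-variables, so Agda cannot infer it
-- from the arguments; it is then supplied as _∘ₑ_ {Z = …}.
idₑ : (X : LO) → X ↪ X
idₑ X = (λ x → x) , λ a b → (λ h → h) , (λ h → h)

infixr 9 _∘ₑ_
_∘ₑ_ : ∀ {X Y Z} → Y ↪ Z → X ↪ Y → X ↪ Z
(g , gemb) ∘ₑ (f , femb) = g ∘ f , λ a b →
  (λ h → proj₁ (gemb (f a) (f b)) (proj₁ (femb a b) h)) ,
  (λ h → proj₂ (femb a b) (proj₂ (gemb (f a) (f b)) h))

≅⇒↪ : ∀ {X Y} → X ≅ Y → X ↪ Y
≅⇒↪ (f , _ , _ , _ , femb) = f , femb

≅⇒↩ : ∀ {X Y} → X ≅ Y → Y ↪ X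
≅⇒↩ {X} {Y} (f , g , _ , fg , femb) = g , λ a b →
  (λ h → proj₂ (femb (g a) (g b)) (subst₂ (Y ⊢_<_) (sym (fg a)) (sym (fg b)) h)) ,
  (λ h → subst₂ (Y ⊢_<_) (fg a) (fg b) (proj₁ (femb (g a) (g b)) h))

≅-linear : ∀ {X Y} → X ≅ Y → IsLinear X → IsLinear Y
≅-linear {X} {Y} X≅Y@(f , g , _ , fg , _) lin = record
  { irreflexive  = λ y h → irreflexive lin (g y) (proj₁ (gemb y y) h)
  ; transitive   = λ {x} {y} {z} a b →
      proj₂ (gemb x z) (transitive lin (proj₁ (gemb x y) a) (proj₁ (gemb y z) b))
  ; trichotomous = compareVia }
  where
  gemb : IsEmbedding Y X g
  gemb = proj₂ (≅⇒↩ X≅Y)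
  compareVia : ∀ x y → Y ⊢ x < y ⊎ x ≡ y ⊎ Y ⊢ y < x
  compareVia x y with trichotomous lin (g x) (g y)
  ... | inj₁ h          = inj₁ (proj₂ (gemb x y) h)
  ... | inj₂ (inj₁ e)   = inj₂ (inj₁ (trans (sym (fg x)) (trans (cong f e) (fg y))))
  ... | inj₂ (inj₂ h)   = inj₂ (inj₂ (proj₂ (gemb y x) h))

monotone⇒embedding : ∀ {X Y} → IsLinear X → IsLinear Y → (f : Carrier X → Carrier Y) →
  (∀ a b → X ⊢ a < b → Y ⊢ f a < f b) → IsEmbedding X Y f
monotone⇒embedding {X} {Y} linX linY f mono a b = mono a b , reflect
  where
  reflect : Y ⊢ f a < f b → X ⊢ a < b
  reflect h with trichotomous linX a b
  ... | inj₁ a<b        = a<b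
  ... | inj₂ (inj₁ refl) = ⊥-elim (irreflexive linY (f a) h)
  ... | inj₂ (inj₂ b<a) = ⊥-elim (irreflexive linY (f a) (transitive linY h (mono b a b<a)))

-- Lexicographic sums.  A sum of a family P over an ordered index set I lives
-- on the dependent pairs (i , x); Σω, Σω* and ΣFin of Defs are instances.
Point : (I : LO) → (Carrier I → LO) → Set
Point I P = Σ (Carrier I) λ i → Carrier (P i)

data Lex (I : LO) (P : Carrier I → LO) : Point I P → Point I P → Set where
  across : ∀ {i j x y} → I ⊢ i < j → Lex I P (i , x) (j , y)
  within : ∀ {i x y} → P i ⊢ x < y → Lex I P (i , x) (i , y)

SumOn : (I : LO) (P : Carrier I → LO) → (Point I P → Point I P → Set) → LO
SumOn I P R = record { Carrier = Point I P ; _<_ = R }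

record IsLexOrder (I : LO) (P : Carrier I → LO) (R : Point I P → Point I P → Set) : Set where
  field
    toLex   : ∀ {p q} → R p q → Lex I P p q
    fromLex : ∀ {p q} → Lex I P p q → R p q
open IsLexOrder public

ℕ↑ ℕ↓ : LO
ℕ↑ = record { Carrier = ℕ ; _<_ = _<ℕ_ }
ℕ↓ = record { Carrier = ℕ ; _<_ = _>_ }

Fin↑ : ℕ → LO
Fin↑ n = record { Carrier = Fin n ; _<_ = _<F_ }

ℕ↑-linear : IsLinear ℕ↑
ℕ↑-linear = strictTotal⇒linear <-isStrictTotalOrder

ℕ↓-linear : IsLinear ℕ↓
ℕ↓-linear = strictTotal⇒linear (Flip.isStrictTotalOrder <-isStrictTotalOrder)

Fin↑-linear : ∀ n → IsLinear (Fin↑ n)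
Fin↑-linear n = strictTotal⇒linear Fin.<-isStrictTotalOrder

Σω-lex : (P : ℕ → LO) → IsLexOrder ℕ↑ P (ωLt P)
Σω-lex P = record { toLex = λ { (fst< l) → across l ; (snd< h) → within h }
                  ; fromLex = λ { (across l) → fst< l ; (within h) → snd< h } }

Σω*-lex : (P : ℕ → LO) → IsLexOrder ℕ↓ P (ω*Lt P)
Σω*-lex P = record { toLex = λ { (fst< l) → across l ; (snd< h) → within h }
                   ; fromLex = λ { (across l) → fst< l ; (within h) → snd< h } }

ΣFin-lex : ∀ n (P : Fin n → LO) → IsLexOrder (Fin↑ n) P (FinLt P)
ΣFin-lex n P = record { toLex = λ { (fst< l) → across l ; (snd< h) → within h }
                      ; fromLex = λ { (across l) → fst< l ; (within h) → snd< h } }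

module LexSum {I : LO} (linI : IsLinear I) {P : Carrier I → LO}
              {R : Point I P → Point I P → Set} (lex : IsLexOrder I P R) where

  S : LO
  S = SumOn I P R

  within⁻¹ : ∀ {i x y} → R (i , x) (i , y) → P i ⊢ x < y
  within⁻¹ h with toLex lex h
  ... | across i<i = ⊥-elim (irreflexive linI _ i<i)
  ... | within x<y = x<y

  linear : (∀ i → IsLinear (P i)) → IsLinear S
  linear linP = record { irreflexive = irr ; transitive = tr ; trichotomous = tri }
    where
    irr : ∀ p → ¬ R p p
    irr (i , x) h = irreflexive (linP i) x (within⁻¹ h)
    trLex : ∀ {p q r} → Lex I P p q → Lex I P q r → Lex I P p r
    trLex (across a) (across b) = across (transitive linI a b)
    trLex (across a) (within _) = across a
    trLex (within _) (across b) = across b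
    trLex {i , _} (within a) (within b) = within (transitive (linP i) a b)
    tr : ∀ {p q r} → R p q → R q r → R p r
    tr a b = fromLex lex (trLex (toLex lex a) (toLex lex b))
    tri : ∀ p q → R p q ⊎ p ≡ q ⊎ R q p
    tri (i , x) (j , y) with trichotomous linI i j
    ... | inj₁ i<j        = inj₁ (fromLex lex (across i<j))
    ... | inj₂ (inj₂ j<i) = inj₂ (inj₂ (fromLex lex (across j<i)))
    ... | inj₂ (inj₁ refl) with trichotomous (linP i) x y
    ...   | inj₁ x<y        = inj₁ (fromLex lex (within x<y))
    ...   | inj₂ (inj₁ refl) = inj₂ (inj₁ refl)
    ...   | inj₂ (inj₂ y<x) = inj₂ (inj₂ (fromLex lex (within y<x)))

  summand : ∀ i → P i ↪ S
  summand i = (i ,_) , λ a b → fromLex lex ∘ within , within⁻¹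

  restrict : ∀ {X m} (F : Carrier X → Point I P) → IsEmbedding X S F → (∀ x → proj₁ (F x) ≡ m) →
    Σ (X ↪ P m) λ G → ∀ x → (m , proj₁ G x) ≡ F x
  restrict {X} {m} F Femb inM = (G , Gemb) , λ x → component≡ (F x) (inM x)
    where
    component : (p : Point I P) → proj₁ p ≡ m → Carrier (P m)
    component (_ , y) refl = y
    component≡ : (p : Point I P) (e : proj₁ p ≡ m) → (m , component p e) ≡ p
    component≡ (_ , _) refl = refl
    component< : ∀ p q (e : proj₁ p ≡ m) (e' : proj₁ q ≡ m) → R p q → P m ⊢ component p e < component q e'
    component< (_ , _) (_ , _) refl refl = within⁻¹
    component> : ∀ p q (e : proj₁ p ≡ m) (e' : proj₁ q ≡ m) → P m ⊢ component p e < component q e' → R p q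
    component> (_ , _) (_ , _) refl refl = fromLex lex ∘ within
    G : Carrier X → Carrier (P m)
    G x = component (F x) (inM x)
    Gemb : IsEmbedding X (P m) G
    Gemb a b = component< (F a) (F b) (inM a) (inM b) ∘ proj₁ (Femb a b) ,
               proj₂ (Femb a b) ∘ component> (F a) (F b) (inM a) (inM b)

  blockwise : ∀ {Q R'} → IsLexOrder I Q R' → (f : ∀ i → P i ↪ Q i) → S ↪ SumOn I Q R'
  blockwise {Q} {R'} lex' f = F , Femb
    where
    F : Point I P → Point I Q
    F (i , x) = i , proj₁ (f i) x
    Femb : IsEmbedding S (SumOn I Q R') F
    Femb (i , x) (j , y) = forward , backward
      where
      forward : R (i , x) (j , y) → R' (F (i , x)) (F (j , y))
      forward h with toLex lex h
      ... | across l = fromLex lex' (across l)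
      ... | within l = fromLex lex' (within (proj₁ (proj₂ (f i) x y) l))
      backward : R' (F (i , x)) (F (j , y)) → R (i , x) (j , y)
      backward h with toLex lex' h
      ... | across l = fromLex lex (across l)
      ... | within l = fromLex lex (within (proj₂ (proj₂ (f i) x y) l))

module ωSum (P : ℕ → LO) = LexSum ℕ↑-linear (Σω-lex P)
module ω*Sum (P : ℕ → LO) = LexSum ℕ↓-linear (Σω*-lex P)
module FinSum (n : ℕ) (P : Fin n → LO) = LexSum (Fin↑-linear n) (ΣFin-lex n P)

ω-index : ∀ {P p q} → ωLt P p q → proj₁ p ≤ proj₁ q
ω-index (fst< l) = <⇒≤ l
ω-index (snd< _) = ≤-refl

ω*-index : ∀ {P p q} → ω*Lt P p q → proj₁ q ≤ proj₁ p
ω*-index (fst< l) = <⇒≤ l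
ω*-index (snd< _) = ≤-refl

Fin-index : ∀ {n} {P : Fin n → LO} {p q} → FinLt P p q → toℕ (proj₁ p) ≤ toℕ (proj₁ q)
Fin-index (fst< l) = <⇒≤ l
Fin-index (snd< _) = ≤-refl

𝓗-linear : ∀ {X} → 𝓗 X → IsLinear X
𝓗-linear one = record { irreflexive = λ _ () ; transitive = λ () ; trichotomous = λ _ _ → inj₂ (inj₁ refl) }
𝓗-linear (ωsum L h _)  = ωSum.linear L (λ i → 𝓗-linear (h i))
𝓗-linear (ω*sum L h _) = ω*Sum.linear L (λ i → 𝓗-linear (h i))
𝓗-linear (iso h X≅Y)   = ≅-linear X≅Y (𝓗-linear h)

𝓗-point : ∀ {X} → 𝓗 X → Carrier X
𝓗-point one           = tt
𝓗-point (ωsum L h _)  = 0 , 𝓗-point (h 0)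
𝓗-point (ω*sum L h _) = 0 , 𝓗-point (h 0)
𝓗-point (iso h X≅Y)   = proj₁ X≅Y (𝓗-point h)

-- Under (*), Σω* N embeds into its own tail beyond any index K: copy j of
-- N j is placed inside a summand N (slot j), the slots strictly increasing.
module TailShift {N : ℕ → LO} (st : Star N) (K : ℕ) where
  slot : ℕ → ℕ
  slot zero    = proj₁ (st 0 K)
  slot (suc j) = proj₁ (st (suc j) (suc (slot j)))

  slot-emb : ∀ j → N j ↪ N (slot j)
  slot-emb zero    = proj₂ (proj₂ (st 0 K))
  slot-emb (suc j) = proj₂ (proj₂ (st (suc j) (suc (slot j))))

  slot-step : ∀ j → slot j <ℕ slot (suc j)
  slot-step j = proj₁ (proj₂ (st (suc j) (suc (slot j))))

  slot-≥K : ∀ j → K ≤ slot j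
  slot-≥K zero    = proj₁ (proj₂ (st 0 K))
  slot-≥K (suc j) = ≤-trans (slot-≥K j) (<⇒≤ (slot-step j))

  slot-increasing : ∀ {j j'} → j <ℕ j' → slot j <ℕ slot j'
  slot-increasing {j} {suc j'} j<1+j' with m≤n⇒m<n∨m≡n (≤-pred j<1+j')
  ... | inj₁ j<j' = <-trans (slot-increasing j<j') (slot-step j')
  ... | inj₂ refl = slot-step j

  shift : Carrier (Σω* N) → Carrier (Σω* N)
  shift (j , z) = slot j , proj₁ (slot-emb j) z

  shift-≥K : ∀ p → K ≤ proj₁ (shift p)
  shift-≥K (j , _) = slot-≥K j

  shift-emb : IsEmbedding (Σω* N) (Σω* N) shift
  shift-emb (j , z) (j' , z') = forward , backward
    where
    forward : ω*Lt N (j , z) (j' , z') → ω*Lt N (shift (j , z)) (shift (j' , z'))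
    forward (fst< j'<j) = fst< (slot-increasing j'<j)
    forward (snd< z<z') = snd< (proj₁ (proj₂ (slot-emb j) z z') z<z')
    backward : ω*Lt N (shift (j , z)) (shift (j' , z')) → ω*Lt N (j , z) (j' , z')
    backward h with <-cmp j j'
    ... | tri< j<j' _ _ = ⊥-elim (<⇒≱ (slot-increasing j<j') (ω*-index h))
    ... | tri≈ _ refl _ = snd< (proj₂ (proj₂ (slot-emb j) z z') (ω*Sum.within⁻¹ N h))
    ... | tri> _ _ j'<j = fst< j'<j

  tail : Σω* N ↪ Σω* N
  tail = shift , shift-emb

-- Excluded middle for propositions in Set (the hypothesis is stated one level up).
decide : ExcludedMiddle (lsuc 0ℓ) → (A : Set) → Dec A
decide em A = map′ lower lift em

-- A bounded monotone ℕ-valued function on the elements of index ≥ K0 is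
-- constant from some index on.  This is where excluded middle is used.
module Stabilisation (em : ExcludedMiddle (lsuc 0ℓ)) {X : Set} (ι : X → ℕ) where

  EventuallyConstant : (X → ℕ) → ℕ → Set
  EventuallyConstant g K0 = ∃ λ K → K0 ≤ K × ∃ λ m → ∀ x → K ≤ ι x → g x ≡ m

  -- Induction on the bound u: either some value drops below u, and beyond
  -- that point the bound is u - 1, or the function is u on the whole tail.
  stabilise↓ : (g : X → ℕ) (K0 u : ℕ) →
    (∀ x y → K0 ≤ ι x → ι x <ℕ ι y → g y ≤ g x) →
    (∀ x → K0 ≤ ι x → g x ≤ u) → EventuallyConstant g K0
  stabilise↓ g K0 u antitone bounded with decide em (∃ λ x → K0 ≤ ι x × g x <ℕ u)
  ... | no noneBelow = K0 , ≤-refl , u , λ x K0≤x →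
          ≤-antisym (bounded x K0≤x) (≮⇒≥ λ gx<u → noneBelow (x , K0≤x , gx<u))
  stabilise↓ g K0 zero    antitone bounded | yes (x , _ , ())
  stabilise↓ g K0 (suc u) antitone bounded | yes (x , K0≤x , gx<u)
    with stabilise↓ g (suc (ι x)) u
           (λ y z x<y y<z → antitone y z (≤-trans K0≤x (<⇒≤ x<y)) y<z)
           (λ y x<y → ≤-trans (antitone x y K0≤x x<y) (≤-pred gx<u))
  ... | K , x<K , rest = K , ≤-trans K0≤x (<⇒≤ x<K) , rest

  stabilise↑ : (g : X → ℕ) (K0 B : ℕ) →
    (∀ x y → K0 ≤ ι x → ι x <ℕ ι y → g x ≤ g y) →
    (∀ x → K0 ≤ ι x → g x ≤ B) → EventuallyConstant g K0
  stabilise↑ g K0 B monotone bounded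
    with stabilise↓ (λ x → B ∸ g x) K0 B
           (λ x y K0≤x x<y → ∸-monoʳ-≤ B (monotone x y K0≤x x<y)) (λ x _ → m∸n≤m B (g x))
  ... | K , K0≤K , m , const = K , K0≤K , B ∸ m , λ x K≤x →
          trans (sym (m∸[m∸n]≡n (bounded x (≤-trans K0≤K K≤x)))) (cong (B ∸_) (const x K≤x))

-- The index is monotone, hence eventually constant, say m; shifting Σω* N
-- into that tail lands the embedding inside P m.
module Collapse (em : ExcludedMiddle (lsuc 0ℓ)) {N P : ℕ → LO} (st : Star N) where
  open Stabilisation em {Carrier (Σω* N)} proj₁

  private
    throughSummand : ∀ {S : LO} {K0} (F : Σω* N ↪ S) (index : Carrier S → ℕ) →
      EventuallyConstant (index ∘ proj₁ F) K0 →
      Σ ℕ λ m → Σ (Σω* N ↪ S) λ G → ∀ x → index (proj₁ G x) ≡ m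
    throughSummand {S} F index (K , _ , m , const) =
      m , _∘ₑ_ {Z = S} F (TailShift.tail st K) , λ x → const (TailShift.shift st K x) (TailShift.shift-≥K st K x)

  collapse* : (F : Σω* N ↪ Σω* P) (K0 B : ℕ) → (∀ x → K0 ≤ proj₁ x → proj₁ (proj₁ F x) ≤ B) →
    ∃ λ m → Σω* N ↪ P m
  collapse* F K0 B bounded
    with throughSummand {Σω* P} F proj₁ (stabilise↑ (proj₁ ∘ proj₁ F) K0 B
           (λ x y _ x<y → ω*-index (proj₁ (proj₂ F y x) (fst< x<y)))
           bounded)
  ... | m , (G , Gemb) , inPm = m , proj₁ (ω*Sum.restrict P G Gemb inPm)

  collapseω : (F : Σω* N ↪ Σω P) (K0 B : ℕ) → (∀ x → K0 ≤ proj₁ x → proj₁ (proj₁ F x) ≤ B) →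
    ∃ λ m → Σω* N ↪ P m
  collapseω F K0 B bounded
    with throughSummand {Σω P} F proj₁ (stabilise↓ (proj₁ ∘ proj₁ F) K0 B
           (λ x y _ x<y → ω-index (proj₁ (proj₂ F y x) (fst< x<y)))
           bounded)
  ... | m , (G , Gemb) , inPm = m , proj₁ (ωSum.restrict P G Gemb inPm)

-- The key lemma: no member Z of 𝓗 can sit between an ω*-sum with (*) and
-- one of its own summands.  By induction on Z: an ω-sum (resp. ω*-sum) Z
-- squeezed this way has one of its summands squeezed in the same way
-- (collapsing the embedding of Σω* N, resp. of Z into itself, into one summand).
NotBetween : LO → Set₁
NotBetween Z = (N : ℕ → LO) → Star N → Σω* N ↪ Z → ∀ j → ¬ (Z ↪ N j)

module _ (em : ExcludedMiddle (lsuc 0ℓ)) where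

  notBetween : ∀ {Z} → 𝓗 Z → NotBetween Z
  notBetween one N st (h , hemb) j (g , _) =
    let (j' , j<j' , (e , _)) = st j (suc j)
    in proj₁ (hemb (j' , e (g tt)) (j , g tt)) (fst< j<j')
  notBetween (ωsum P hP stP) N st h j g =
    let (m , Σω*N↪Pm) = collapsed in notBetween (hP m) N st Σω*N↪Pm j (_∘ₑ_ {Z = N j} g (ωSum.summand P m))
    where
    -- Everything beyond index j lies below (j , y), so its image has ω-index at most that of (j , y).
    y : Carrier (N j)
    y = proj₁ g (𝓗-point (ωsum P hP stP))
    bounded : ∀ x → suc j ≤ proj₁ x → proj₁ (proj₁ h x) ≤ proj₁ (proj₁ h (j , y))
    bounded x j<x = ω-index (proj₁ (proj₂ h x (j , y)) (fst< j<x))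
    collapsed : ∃ λ m → Σω* N ↪ P m
    collapsed = Collapse.collapseω em st h (suc j) _ bounded
  notBetween (ω*sum P hP stP) N st h j g =
    let (m , Σω*P↪Pm) = collapsed in notBetween (hP m) P stP Σω*P↪Pm m (idₑ (P m))
    where
    -- F maps Z into itself above the point w, so F has bounded ω*-index.
    F : Σω* P ↪ Σω* P
    F = _∘ₑ_ {Z = Σω* P} h (_∘ₑ_ {Z = Σω* N} (ω*Sum.summand N j) g)
    later : ∃ λ j' → suc j ≤ j' × (N j ↪ N j')
    later = st j (suc j)
    w : Carrier (Σω* P)
    w = proj₁ h (proj₁ later , proj₁ (proj₂ (proj₂ later)) (proj₁ g (𝓗-point (ω*sum P hP stP))))
    bounded : ∀ z → 0 ≤ proj₁ z → proj₁ (proj₁ F z) ≤ proj₁ w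
    bounded z _ = ω*-index (proj₁ (proj₂ h _ (j , _)) (fst< (proj₁ (proj₂ later))))
    collapsed : ∃ λ m → Σω* P ↪ P m
    collapsed = Collapse.collapse* em stP F 0 (proj₁ w) bounded
  notBetween {Z} (iso {X} hX X≅Z) N st h j g =
    notBetween hX N st (_∘ₑ_ {Z = X} (≅⇒↩ {X} {Z} X≅Z) h) j (_∘ₑ_ {Z = N j} g (≅⇒↪ {X} {Z} X≅Z))

  noSummandAbsorbs : (M : ℕ → LO) → (∀ k → 𝓗 (M k)) → Star M → ∀ k → ¬ (Σω* M ↪ M k)
  noSummandAbsorbs M hM st k e = notBetween (hM k) M st e k (idₑ (M k))

_◂_ : LO → (ℕ → LO) → ℕ → LO
(X ◂ A) zero    = X
(X ◂ A) (suc k) = A k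

◂-≅ : ∀ X A → Σω* (X ◂ A) ≅ (Σω* A ⊕ X)
◂-≅ X A = f , g , gf , fg , femb
  where
  f : Carrier (Σω* (X ◂ A)) → Carrier (Σω* A ⊕ X)
  f (zero , x)  = inj₂ x
  f (suc k , y) = inj₁ (k , y)
  g : Carrier (Σω* A ⊕ X) → Carrier (Σω* (X ◂ A))
  g (inj₁ (k , y)) = suc k , y
  g (inj₂ x)       = zero , x
  gf : ∀ p → g (f p) ≡ p
  gf (zero , _)  = refl
  gf (suc _ , _) = refl
  fg : ∀ q → f (g q) ≡ q
  fg (inj₁ _) = refl
  fg (inj₂ _) = refl
  femb : IsEmbedding (Σω* (X ◂ A)) (Σω* A ⊕ X) f
  femb (zero , _)  (zero , _)   = (λ { (snd< h) → rr h ; (fst< ()) }) , λ { (rr h) → snd< h }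
  femb (zero , _)  (suc _ , _)  = (λ { (fst< ()) }) , λ ()
  femb (suc _ , _) (zero , _)   = (λ _ → lr) , (λ _ → fst< (s≤s z≤n))
  femb (suc _ , _) (suc _ , _)  = (λ { (fst< (s≤s l)) → ll (fst< l) ; (snd< h) → ll (snd< h) }) ,
                                  λ { (ll (fst< l)) → fst< (s≤s l) ; (ll (snd< h)) → snd< h }

◂-star : ∀ {X A k} → Star A → X ↪ A k → Star (X ◂ A)
◂-star {A = A} {k} st X↪Ak zero m =
  let (j , m≤j , Ak↪Aj) = st k m in suc j , m≤n⇒m≤1+n m≤j , _∘ₑ_ {Z = A j} Ak↪Aj X↪Ak
◂-star st _ (suc i) m =
  let (j , m≤j , Ai↪Aj) = st i m in suc j , m≤n⇒m≤1+n m≤j , Ai↪Aj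

-- Adjacent blocks: if Σω* A + Σω* B ∉ 𝓗, then Σω* B embeds into no summand of A;
-- otherwise Σω* (Σω* B ◂ A) ∈ 𝓗 would be a copy of Σω* A + Σω* B.
notBelowNeighbour : (A B : ℕ → LO) → (∀ k → 𝓗 (A k)) → (∀ k → 𝓗 (B k)) → Star A → Star B →
  ¬ 𝓗 (Σω* A ⊕ Σω* B) → ∀ k → ¬ (Σω* B ↪ A k)
notBelowNeighbour A B hA hB stA stB notInH k B↪Ak =
  notInH (iso (ω*sum (Σω* B ◂ A) inH (◂-star stA B↪Ak)) (◂-≅ (Σω* B) A))
  where
  inH : ∀ i → 𝓗 ((Σω* B ◂ A) i)
  inH zero    = ω*sum B hB stB
  inH (suc i) = hA i

BlockSum : (n : ℕ) → (Fin n → ℕ → LO) → LO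
BlockSum n M = ΣFin n (λ i → Σω* (M i))

-- Part (a).  Throughout, L = Σ_{i<n} Block i with Block i = Σω* (M i) as in
-- the theorem; points of L are (i , j , z) with i the block, j the depth.
module Blocks (em : ExcludedMiddle (lsuc 0ℓ)) (n : ℕ) (M : Fin n → ℕ → LO)
  (hM : ∀ i j → 𝓗 (M i j)) (stM : ∀ i → Star (M i))
  (adjacent : ∀ (i i' : Fin n) → toℕ i' ≡ suc (toℕ i) → ¬ 𝓗 (Σω* (M i) ⊕ Σω* (M i'))) where

  Block : Fin n → LO
  Block i = Σω* (M i)

  L : LO
  L = BlockSum n M

  block : Carrier L → ℕ
  block p = toℕ (proj₁ p)

  depth : Carrier L → ℕ
  depth p = proj₁ (proj₂ p)

  point : ∀ i → Carrier (Block i)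
  point i = 0 , 𝓗-point (hM i 0)

  noSelf : ∀ i m → ¬ (Block i ↪ M i m)
  noSelf i = noSummandAbsorbs em (M i) (hM i) (stM i)

  noPredecessor : ∀ i i' → toℕ i' ≡ suc (toℕ i) → ∀ m → ¬ (Block i' ↪ M i m)
  noPredecessor i i' i'=i+1 =
    notBelowNeighbour (M i) (M i') (hM i) (hM i') (stM i) (stM i') (adjacent i i' i'=i+1)

  pinned : ∀ p j → block p ≤ toℕ j → toℕ j ≤ block p → proj₁ p ≡ j
  pinned p j ≤j j≤ = Fin.toℕ-injective (≤-antisym ≤j j≤)

  sameBlock-depth : ∀ p q → proj₁ p ≡ proj₁ q → FinLt Block p q → depth q ≤ depth p
  sameBlock-depth (i , _) (i , _) refl p<q = ω*-index (FinSum.within⁻¹ n Block p<q)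

  deeper⇒below : ∀ p q → proj₁ p ≡ proj₁ q → depth q <ℕ depth p → FinLt Block p q
  deeper⇒below (i , _) (i , _) refl deeper = snd< (fst< deeper)

  intoBlock : ∀ a b (F : Block a ↪ L) → (∀ x → proj₁ (proj₁ F x) ≡ b) →
    (B : ℕ) → (∀ x → depth (proj₁ F x) ≤ B) → ∃ λ m → Block a ↪ M b m
  intoBlock a b (F , Femb) inB B bounded =
    Collapse.collapse* em (stM a) G 0 B λ x _ → subst (_≤ B) (cong (proj₁ ∘ proj₂) (sym (G≡F x))) (bounded x)
    where
    G : Block a ↪ Block b
    G = proj₁ (FinSum.restrict n Block F Femb inB)
    G≡F : ∀ x → (b , proj₁ G x) ≡ F x
    G≡F = proj₂ (FinSum.restrict n Block F Femb inB)

  module SelfEmbedding (f : Carrier L → Carrier L) (femb : IsEmbedding L L f) where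

    f< : ∀ {p q} → FinLt Block p q → FinLt Block (f p) (f q)
    f< {p} {q} = proj₁ (femb p q)

    collapseImage : ∀ i b K → (∀ t → K ≤ proj₁ t → proj₁ (f (i , t)) ≡ b) →
      (B : ℕ) → (∀ t → K ≤ proj₁ t → depth (f (i , t)) ≤ B) → ∃ λ m → Block i ↪ M b m
    collapseImage i b K inB B bounded =
      intoBlock i b F (λ x → inB _ (shift-≥K x)) B (λ x → bounded _ (shift-≥K x))
      where
      open TailShift (stM i) K using (tail; shift-≥K)
      F : Block i ↪ L
      F = _∘ₑ_ {Z = L} (f , femb) (_∘ₑ_ {Z = L} (FinSum.summand n Block i) tail)

    -- No point is moved to a lower block.  Otherwise, with i₋ the block below
    -- i, the tail of Block i beyond x is squeezed into block i₋ above f of a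
    -- point of Block i₋ (which by induction stays in block i₋ or higher).
    lowerBound : ∀ k i → toℕ i ≡ k → ∀ x → k ≤ block (f (i , x))
    lowerBound zero    i _   x = z≤n
    lowerBound (suc k) i i=k+1 x with suc k ≤? block (f (i , x))
    ... | yes k<fx = k<fx
    ... | no  k≮fx = ⊥-elim (noPredecessor i₋ i i=i₋+1 _ (proj₂ collapsed))
      where
      k<n : k <ℕ n
      k<n = ≤-trans (n≤1+n _) (subst (_<ℕ n) i=k+1 (Fin.toℕ<n i))
      i₋ : Fin n
      i₋ = fromℕ< k<n
      i₋=k : toℕ i₋ ≡ k
      i₋=k = Fin.toℕ-fromℕ< k<n
      i=i₋+1 : toℕ i ≡ suc (toℕ i₋)
      i=i₋+1 = trans i=k+1 (cong suc (sym i₋=k))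
      i₋<i : i₋ <F i
      i₋<i = subst (toℕ i₋ <ℕ_) (sym i=i₋+1) ≤-refl
      v : Carrier L
      v = f (i₋ , point i₋)
      k≤v : toℕ i₋ ≤ block v
      k≤v = subst (_≤ block v) (sym i₋=k) (lowerBound k i₋ i₋=k (point i₋))
      fx≤k : block (f (i , x)) ≤ toℕ i₋
      fx≤k = subst (block (f (i , x)) ≤_) (sym i₋=k) (≤-pred (≰⇒> k≮fx))
      inBlock : ∀ t → suc (proj₁ x) ≤ proj₁ t → proj₁ (f (i , t)) ≡ i₋
      inBlock t beyond = pinned (f (i , t)) i₋
        (≤-trans (Fin-index (f< {i , t} {i , x} (snd< (fst< beyond)))) fx≤k)
        (≤-trans k≤v (Fin-index (f< {i₋ , point i₋} {i , t} (fst< i₋<i))))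
      v-inBlock : proj₁ v ≡ i₋
      v-inBlock = pinned v i₋ (≤-trans (Fin-index (f< {i₋ , point i₋} {i , x} (fst< i₋<i))) fx≤k) k≤v
      collapsed : ∃ λ m → Block i ↪ M i₋ m
      collapsed = collapseImage i i₋ (suc (proj₁ x)) inBlock (depth v) λ t beyond →
        sameBlock-depth v (f (i , t)) (trans v-inBlock (sym (inBlock t beyond))) (f< (fst< i₋<i))

    -- By downward induction: if f x
    -- left block i, it would land in block i₊ (which f preserves, by
    -- induction and lowerBound), and all of f[Block i₊] would be squeezed
    -- into block i₊ above f x.
    upperBound : ∀ d i → n ≡ suc (toℕ i) + d → ∀ x → block (f (i , x)) ≤ toℕ i
    upperBound zero i n=i+1 x =
      ≤-pred (subst (block (f (i , x)) <ℕ_) (trans n=i+1 (+-identityʳ _)) (Fin.toℕ<n _))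
    upperBound (suc d) i n=i+1+d x with block (f (i , x)) ≤? toℕ i
    ... | yes fx≤i = fx≤i
    ... | no  fx≰i = ⊥-elim (noSelf i₊ _ (proj₂ collapsed))
      where
      i+1<n : suc (toℕ i) <ℕ n
      i+1<n = subst (suc (toℕ i) <ℕ_) (sym n=i+1+d) (m<m+n (suc (toℕ i)) (s≤s z≤n))
      i₊ : Fin n
      i₊ = fromℕ< i+1<n
      i₊=i+1 : toℕ i₊ ≡ suc (toℕ i)
      i₊=i+1 = Fin.toℕ-fromℕ< i+1<n
      i<i₊ : i <F i₊
      i<i₊ = subst (toℕ i <ℕ_) (sym i₊=i+1) ≤-refl
      n=i₊+1+d : n ≡ suc (toℕ i₊) + d
      n=i₊+1+d = trans n=i+1+d (trans (cong suc (+-suc (toℕ i) d)) (cong (λ t → suc t + d) (sym i₊=i+1)))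
      preserved : ∀ z → proj₁ (f (i₊ , z)) ≡ i₊
      preserved z = pinned (f (i₊ , z)) i₊ (upperBound d i₊ n=i₊+1+d z) (lowerBound (toℕ i₊) i₊ refl z)
      fx-inBlock : proj₁ (f (i , x)) ≡ i₊
      fx-inBlock = pinned (f (i , x)) i₊
        (≤-trans (Fin-index (f< {i , x} {i₊ , point i₊} (fst< i<i₊))) (≤-reflexive (cong toℕ (preserved _))))
        (subst (_≤ block (f (i , x))) (sym i₊=i+1) (≰⇒> fx≰i))
      collapsed : ∃ λ m → Block i₊ ↪ M i₊ m
      collapsed = collapseImage i₊ i₊ 0 (λ t _ → preserved t) (depth (f (i , x))) λ t _ →
        sameBlock-depth (f (i , x)) (f (i₊ , t)) (trans fx-inBlock (sym (preserved t))) (f< (fst< i<i₊))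

    preserves : ∀ i x → proj₁ (f (i , x)) ≡ i
    preserves i x = pinned (f (i , x)) i
      (upperBound (n ∸ suc (toℕ i)) i (sym (m+[n∸m]≡n (Fin.toℕ<n i))) x)
      (lowerBound (toℕ i) i refl x)

    -- f[Block i] is coinitial in Block i: every point v of block i lies above
    -- f of a whole tail of Block i.  Otherwise f[Block i] would have bounded
    -- depth and Block i would collapse into one of its own summands.
    coinitial : ∀ i v → proj₁ v ≡ i → ∃ λ J → ∀ x → J ≤ proj₁ x → FinLt Block (f (i , x)) v
    coinitial i v v-inBlock with decide em (∃ λ x → depth v <ℕ depth (f (i , x)))
    ... | yes (x , deeper) = suc (proj₁ x) , λ x' beyond →
          deeper⇒below (f (i , x')) v (trans (preserves i x') (sym v-inBlock))
            (<-≤-trans deeper (sameBlock-depth (f (i , x')) (f (i , x))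
              (trans (preserves i x') (sym (preserves i x))) (f< (snd< (fst< beyond)))))
    ... | no shallow = ⊥-elim (noSelf i _ (proj₂ collapsed))
      where
      collapsed : ∃ λ m → Block i ↪ M i m
      collapsed = collapseImage i i 0 (λ t _ → preserves i t) (depth v)
        (λ t _ → ≮⇒≥ λ deeper → shallow (t , deeper))

Image : ∀ {X} → (Carrier X → Carrier X) → Subset X
Image g y = ∃ λ x → g x ≡ y

image-ℙ : ∀ {X} (g : X ↪ X) → ℙ X (Image {X} (proj₁ g))
image-ℙ (g , gemb) = g , gemb , (λ x → x , refl) , (λ _ inImage → inImage)

module Decomposition (n : ℕ) (P : Fin n → LO)
  (preserves : ∀ f → IsEmbedding (ΣFin n P) (ΣFin n P) f → ∀ i x → proj₁ (f (i , x)) ≡ i) where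

  L : LO
  L = ΣFin n P

  UnionOfCopies : Subset L → Set₁
  UnionOfCopies A = ∃ λ (C : (i : Fin n) → Subset (P i)) →
    (∀ i → ℙ (P i) (C i)) × (∀ i x → (A (i , x) → C i x) × (C i x → A (i , x)))

  -- A copy A = g[L] meets block i in g[block i], a copy of that block.
  copy⇒union : ∀ A → ℙ L A → UnionOfCopies A
  copy⇒union A (g , gemb , inA , onto) = (λ i x → A (i , x)) , blockCopy , λ i x → (λ h → h) , (λ h → h)
    where
    blockCopy : ∀ i → ℙ (P i) (λ x → A (i , x))
    blockCopy i = gᵢ , gᵢemb , (λ x → subst A (sym (gᵢ≡g x)) (inA (i , x))) , ontoᵢ
      where
      restricted : Σ (P i ↪ P i) λ G → ∀ x → (i , proj₁ G x) ≡ g (i , x)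
      restricted = FinSum.restrict n P (g ∘ (i ,_)) (proj₂ (_∘ₑ_ {Z = L} (g , gemb) (FinSum.summand n P i)))
                     (preserves g gemb i)
      gᵢ : Carrier (P i) → Carrier (P i)
      gᵢ = proj₁ (proj₁ restricted)
      gᵢemb : IsEmbedding (P i) (P i) gᵢ
      gᵢemb = proj₂ (proj₁ restricted)
      gᵢ≡g : ∀ x → (i , gᵢ x) ≡ g (i , x)
      gᵢ≡g = proj₂ restricted
      fromPreimage : ∀ i' x y → i' ≡ i → g (i' , x) ≡ (i , y) → ∃ λ x' → gᵢ x' ≡ y
      fromPreimage _ x y refl gx≡y = x , ,-injectiveʳ-UIP uip (trans (gᵢ≡g x) gx≡y)
      ontoᵢ : ∀ y → A (i , y) → ∃ λ x → gᵢ x ≡ y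
      ontoᵢ y Ay with onto (i , y) Ay
      ... | (i' , x) , gx≡y = fromPreimage i' x y (trans (sym (preserves g gemb i' x)) (cong proj₁ gx≡y)) gx≡y

  union⇒copy : ∀ A → UnionOfCopies A → ℙ L A
  union⇒copy A (C , copies , A⇔C) = G , Gemb , inA , onto
    where
    glued : L ↪ L
    glued = FinSum.blockwise n P (ΣFin-lex n P) (λ i → proj₁ (copies i) , proj₁ (proj₂ (copies i)))
    G : Carrier L → Carrier L
    G = proj₁ glued
    Gemb : IsEmbedding L L G
    Gemb = proj₂ glued
    inA : ∀ p → A (G p)
    inA (i , x) = proj₂ (A⇔C i _) (proj₁ (proj₂ (proj₂ (copies i))) x)
    onto : ∀ p → A p → ∃ λ q → G q ≡ p
    onto (i , y) Ay with proj₂ (proj₂ (proj₂ (copies i))) y (proj₁ (A⇔C i y) Ay)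
    ... | x , gx≡y = (i , x) , cong (i ,_) gx≡y

Leℙ-trans : ∀ {X A B C} → Leℙ X A B → Leℙ X B C → Leℙ X A C
Leℙ-trans A≤B B≤C D Dcopy D⊆A with A≤B D Dcopy D⊆A
... | E , Ecopy , E⊆D , E⊆B with B≤C E Ecopy E⊆B
... | F , Fcopy , F⊆E , F⊆C = F , Fcopy , (λ x → E⊆D x ∘ F⊆E x) , F⊆C

module DescendingChain {X : LO} (p : ℕ → Subset X) (copies : ∀ k → ℙ X (p k))
  (descending : ∀ k → Leℙ X (p (suc k)) (p k)) where

  belowAll : ∀ k (C : Subset X) → ℙ X C → _⊆_ {X} C (p k) →
    ∃ λ (Y : Subset X) → ℙ X Y × _⊆_ {X} Y C × (∀ k' → k' ≤ k → _⊆_ {X} Y (p k'))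
  belowAll zero C Ccopy C⊆p₀ = C , Ccopy , (λ _ h → h) , λ { .zero z≤n → C⊆p₀ }
  belowAll (suc k) C Ccopy C⊆p with descending k C Ccopy C⊆p
  ... | D , Dcopy , D⊆C , D⊆pₖ with belowAll k D Dcopy D⊆pₖ
  ... | Y , Ycopy , Y⊆D , Y⊆earlier = Y , Ycopy , (λ x → D⊆C x ∘ Y⊆D x) , Y⊆p
    where
    Y⊆p : ∀ k' → k' ≤ suc k → _⊆_ {X} Y (p k')
    Y⊆p k' k'≤k+1 with m≤n⇒m<n∨m≡n k'≤k+1
    ... | inj₁ k'<k+1 = Y⊆earlier k' (≤-pred k'<k+1)
    ... | inj₂ refl   = λ x → C⊆p x ∘ D⊆C x ∘ Y⊆D x

  common : ∀ k → ∃ λ (Y : Subset X) → ℙ X Y × (∀ k' → k' ≤ k → _⊆_ {X} Y (p k'))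
  common k = let (Y , Ycopy , _ , Y⊆p) = belowAll k (p k) (copies k) (λ _ h → h) in Y , Ycopy , Y⊆p

  e : ℕ → Carrier X → Carrier X
  e k = proj₁ (proj₁ (proj₂ (common k)))

  e-emb : ∀ k → IsEmbedding X X (e k)
  e-emb k = proj₁ (proj₂ (proj₁ (proj₂ (common k))))

  e-in : ∀ k k' → k' ≤ k → ∀ x → p k' (e k x)
  e-in k k' k'≤k x =
    proj₂ (proj₂ (common k)) k' k'≤k _ (proj₁ (proj₂ (proj₂ (proj₁ (proj₂ (common k))))) x)

-- Given p₀ ≥ p₁ ≥ ⋯, let e_j be a self-embedding with image in p₀, …, p_j.
-- In block i we place a copy ψ_j of M i j inside e_j[Block i], with marker
-- points v_j separating the copies: ψ_{j+1} < v_j < ψ_j (coinitiality lets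
-- ψ_{j+1} go below v_j).  The union q of all copies is again a copy of L,
-- and below v_k only copies ψ_j with j > k remain, all inside p_{k+1}.
module Fusion (n : ℕ) (M : Fin n → ℕ → LO) (linear : ∀ i j → IsLinear (M i j))
  (pt : ∀ i j → Carrier (M i j)) (stM : ∀ i → Star (M i))
  (preserves : ∀ f → IsEmbedding (BlockSum n M) (BlockSum n M) f → ∀ i x → proj₁ (f (i , x)) ≡ i)
  (coinitial : ∀ f → IsEmbedding (BlockSum n M) (BlockSum n M) f → ∀ i v → proj₁ v ≡ i →
     ∃ λ J → ∀ x → J ≤ proj₁ x → FinLt (λ i → Σω* (M i)) (f (i , x)) v) where

  Block : Fin n → LO
  Block i = Σω* (M i)

  L : LO
  L = BlockSum n M

  infix 4 _≺_
  _≺_ : Carrier L → Carrier L → Set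
  _≺_ = FinLt Block

  linL : IsLinear L
  linL = FinSum.linear n Block (λ i → ω*Sum.linear (M i) (linear i))

  blocks< : ∀ p q {i i'} → proj₁ p ≡ i → proj₁ q ≡ i' → i <F i' → p ≺ q
  blocks< (_ , _) (_ , _) refl refl i<i' = fst< i<i'

  module Construction (p : ℕ → Subset L) (copies : ∀ k → ℙ L (p k))
    (descending : ∀ k → Leℙ L (p (suc k)) (p k)) where
    open DescendingChain p copies descending

    module Column (i : Fin n) where
      -- A point of e_j[Block i] just below the copy placed at depth m.
      marker : ℕ → ℕ → Carrier L
      marker j m = e j (i , suc m , pt i (suc m))

      -- Beyond this depth, e_{j+1}[Block i] lies below marker j m.
      threshold : ℕ → ℕ → ℕ
      threshold j m = proj₁ (coinitial (e (suc j)) (e-emb (suc j)) i (marker j m) (preserves (e j) (e-emb j) i _))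

      slot : ℕ → ℕ
      slot zero    = proj₁ (stM i 0 0)
      slot (suc j) = proj₁ (stM i (suc j) (threshold j (slot j)))

      slot-emb : ∀ j → M i j ↪ M i (slot j)
      slot-emb zero    = proj₂ (proj₂ (stM i 0 0))
      slot-emb (suc j) = proj₂ (proj₂ (stM i (suc j) (threshold j (slot j))))

      v : ℕ → Carrier L
      v j = marker j (slot j)

      ψ : ∀ j → Carrier (M i j) → Carrier L
      ψ j z = e j (i , slot j , proj₁ (slot-emb j) z)

      ψ-emb : ∀ j → IsEmbedding (M i j) L (ψ j)
      ψ-emb j = proj₂ (_∘ₑ_ {Z = L} (e j , e-emb j) (_∘ₑ_ {Z = L} (FinSum.summand n Block i)
                  (_∘ₑ_ {Z = Block i} (ω*Sum.summand (M i) (slot j)) (slot-emb j))))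

      ψ-block : ∀ j z → proj₁ (ψ j z) ≡ i
      ψ-block j z = preserves (e j) (e-emb j) i _

      v-block : ∀ j → proj₁ (v j) ≡ i
      v-block j = preserves (e j) (e-emb j) i _

      v<ψ : ∀ j z → v j ≺ ψ j z
      v<ψ j z = proj₁ (e-emb j _ _) (snd< (fst< ≤-refl))

      ψ<v : ∀ j z → ψ (suc j) z ≺ v j
      ψ<v j z = proj₂ (coinitial (e (suc j)) (e-emb (suc j)) i (v j) (v-block j)) _
                  (proj₁ (proj₂ (stM i (suc j) (threshold j (slot j)))))

      ψ<earlier-v : ∀ j' j → j' <ℕ j → ∀ z → ψ j z ≺ v j'
      ψ<earlier-v j' (suc j) j'<j+1 z with m≤n⇒m<n∨m≡n (≤-pred j'<j+1)
      ... | inj₂ refl  = ψ<v j' z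
      ... | inj₁ j'<j = transitive linL (ψ<v j z)
                          (transitive linL (v<ψ j (pt i j)) (ψ<earlier-v j' j j'<j (pt i j)))

      below-marker : ∀ k j z → ψ j z ≺ v k → k <ℕ j
      below-marker k j z ψ<vₖ with <-cmp k j
      ... | tri< k<j _ _ = k<j
      ... | tri≈ _ refl _ = ⊥-elim (irreflexive linL _ (transitive linL ψ<vₖ (v<ψ j z)))
      ... | tri> _ _ j<k = ⊥-elim (irreflexive linL _
              (transitive linL ψ<vₖ (transitive linL (v<ψ k (pt i k))
                (transitive linL (ψ<earlier-v j k j<k (pt i k)) (v<ψ j z)))))

    open Column using (ψ; ψ-block; v; v-block)

    G : Carrier L → Carrier L
    G (i , j , z) = ψ i j z

    G-monotone : ∀ a b → a ≺ b → G a ≺ G b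
    G-monotone (i , j , z) (i' , j' , z') (fst< i<i') =
      blocks< (G (i , j , z)) (G (i' , j' , z')) (ψ-block i j z) (ψ-block i' j' z') i<i'
    G-monotone (i , j , z) (i , j' , z') (snd< (fst< j'<j)) =
      transitive linL (Column.ψ<earlier-v i j' j j'<j z) (Column.v<ψ i j' z')
    G-monotone (i , j , z) (i , j , z') (snd< (snd< z<z')) = proj₁ (Column.ψ-emb i j z z') z<z'

    q : Subset L
    q = Image {L} G

    q-copy : ℙ L q
    q-copy = image-ℙ (G , monotone⇒embedding linL linL G G-monotone)

    -- q ≤ p_{k+1}: a copy C = c[L] ⊆ q contains the copy D = c[φ[L]], where φ
    -- shifts each block so deep that c sends it below the marker v k; D then
    -- consists of points ψ_j z with j > k, which lie in p_{k+1}.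
    q≤next : ∀ k → Leℙ L q (p (suc k))
    q≤next k C (c , cemb , inC , _) C⊆q = Image {L} (proj₁ H) , image-ℙ H , D⊆C , D⊆next
      where
      depthBound : ∀ i → ∃ λ J → ∀ x → J ≤ proj₁ x → c (i , x) ≺ v i k
      depthBound i = coinitial c cemb i (v i k) (v-block i k)
      φ : L ↪ L
      φ = FinSum.blockwise n Block (ΣFin-lex n Block) λ i → TailShift.tail (stM i) (proj₁ (depthBound i))
      H : L ↪ L
      H = _∘ₑ_ {Z = L} (c , cemb) φ
      D⊆C : _⊆_ {L} (Image {L} (proj₁ H)) C
      D⊆C _ (x , refl) = inC (proj₁ φ x)
      inNext : ∀ i i' j z y → G (i' , j , z) ≡ y → i' ≡ i → y ≺ v i k → p (suc k) y
      inNext i _ j z _ refl refl ψ<vₖ = e-in j (suc k) (Column.below-marker i k j z ψ<vₖ) _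
      D⊆next : _⊆_ {L} (Image {L} (proj₁ H)) (p (suc k))
      D⊆next _ ((i , x) , refl) with C⊆q _ (inC (proj₁ φ (i , x)))
      ... | (i' , j , z) , Gz≡y = inNext i i' j z _ Gz≡y
              (trans (sym (ψ-block i' j z)) (trans (cong proj₁ Gz≡y) (preserves c cemb i _)))
              (proj₂ (depthBound i) _ (TailShift.slot-≥K (stM i) _ (proj₁ x)))

  σ-closed : σClosed L
  σ-closed p copies descending = q , q-copy , λ k → Leℙ-trans {L} (q≤next k) (descending k)
    where open Construction p copies descending

proposition4p4 : ExcludedMiddle (lsuc 0ℓ) →
    (n : ℕ) → (M : Fin n → ℕ → LO) →
    (∀ i j → 𝓗 (M i j)) → (∀ i → Star (M i)) →
    (∀ (i i' : Fin n) → toℕ i' ≡ suc (toℕ i) → ¬ 𝓗 (Σω* (M i) ⊕ Σω* (M i'))) →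
    let Li = λ (i : Fin n) → Σω* (M i)
        L = ΣFin n Li
    in ((f : Carrier L → Carrier L) → IsEmbedding L L f →
          ∀ i x → proj₁ (f (i , x)) ≡ i)
       × (∀ (A : Subset L) →
          (ℙ L A → ∃ λ (C : (i : Fin n) → Subset (Li i)) →
                     (∀ i → ℙ (Li i) (C i)) × (∀ i x → (A (i , x) → C i x) × (C i x → A (i , x))))
          × ((∃ λ (C : (i : Fin n) → Subset (Li i)) →
                     (∀ i → ℙ (Li i) (C i)) × (∀ i x → (A (i , x) → C i x) × (C i x → A (i , x))))
             → ℙ L A))
       × σClosed L
proposition4p4 em n M hM stM adjacent = partA , partB , partC
  where
  open Blocks em n M hM stM adjacent using (Block; module SelfEmbedding)

  partA : ∀ f → IsEmbedding (BlockSum n M) (BlockSum n M) f → ∀ i x → proj₁ (f (i , x)) ≡ i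
  partA f femb = SelfEmbedding.preserves f femb

  open Decomposition n Block partA using (UnionOfCopies; copy⇒union; union⇒copy)

  partB : ∀ A → (ℙ (BlockSum n M) A → UnionOfCopies A) × (UnionOfCopies A → ℙ (BlockSum n M) A)
  partB A = copy⇒union A , union⇒copy A

  partC : σClosed (BlockSum n M)
  partC = Fusion.σ-closed n M (λ i j → 𝓗-linear (hM i j)) (λ i j → 𝓗-point (hM i j)) stM partA
            (λ f femb → SelfEmbedding.coinitial f femb)
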